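{- Let $\mathcal{S}=\langle S,\nu\rangle$ be a neighbourhood frame and $R\subseteq S\times S$ an equivalence relation. Then: $R$ is a $2^2$-bisimulation (between $\mathcal{S}$ and $\mathcal{S}$) iff $R$ is a precocongruence (between $\mathcal{S}$ and $\mathcal{S}$) iff $R$ is a congruence on $\mathcal{S}$. Consequently, for all $s_1,s_2\in S$: $s_1,s_2$ are $2^2$-bisimilar iff they are related by a precocongruence iff they are behaviourally equivalent (all relative to $\mathcal{S}$ and $\mathcal{S}$).
   Context: A neighbourhood frame is $\langle S,\nu\rangle$ with $\nu\colon S\to\mathcal{P}(\mathcal{P}(S))$. $f\colon S_1\to S_2$ is a bounded morphism $\langle S_1,\nu_1\rangle\to\langle S_2,\nu_2\rangle$ if $f^{ -1}[X]\in\nu_1(s)$ iff $X\in\nu_2(f(s))$ for all $s\in S_1,X\subseteq S_2$. $R\subseteq S_1\times S_2$ is a $2^2$-bisimulation if $R$ carries a neighbourhood function making both projections bounded morphisms; states are $2^2$-bisimilar if related by one. $R$ is a precocongruence if its pushout $\langle P,p_1,p_2\rangle$ in $\mathbf{Set}$ ($P=(S_1+S_2)/\theta$, $\theta$ the equivalence relation generated by $(\iota_1(x_1),\iota_2(x_2))$ for $(x_1,x_2)\in R$, $p_i$ inclusion followed by quotient) carries a neighbourhood function making $p_1,p_2$ bounded morphisms. An equivalence relation $R$ on $S$ is a congruence if $S/R$ carries a neighbourhood function making the quotient map a bounded morphism. States $s_1\in S_1,s_2\in S_2$ are behaviourally equivalent if there are bounded morphisms $f_i$ from $\langle S_i,\nu_i\rangle$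 into a common neighbourhood frame with $f_1(s_1)=f_2(s_2)$. -}

module Defs where

open import Level using (0ℓ)
open import Function.Base using (_∘_; id)
open import Function.Bundles using (_⇔_)
open import Data.Product using (Σ; Σ-syntax; _×_; _,_; proj₁; proj₂)
open import Data.Sum using (_⊎_; inj₁; inj₂)
open import Relation.Unary using (Pred; _≐_)
open import Relation.Binary.Core using (Rel)
open import Relation.Binary.Definitions using (_Respects_)
open import Relation.Binary.Structures using (IsEquivalence)
open import Relation.Binary.PropositionalEquality
  using (_≡_; refl; sym; trans; subst)
import Relation.Binary.PropositionalEquality as PE
open import Relation.Binary.Construct.Closure.Equivalence as EqC
  using (EqClosure)

-- Subsets of a type A are predicates  A → Set.  P(S) in the paper is
-- extensional, so neighbourhood functions are required to be invariant
-- under extensional equality  _≐_  of subsets.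

record Frame : Set₁ where
  field
    S     : Set
    ν     : S → Pred S 0ℓ → Set
    ν-ext : ∀ s {X Y : Pred S 0ℓ} → X ≐ Y → ν s X → ν s Y

-- Quotient sets are represented as setoids (carrier + equivalence).
-- A subset of the quotient  A/≈  is a ≈-closed predicate on A.
-- A neighbourhood function on A/≈ is given by its values on ≈-closed
-- predicates; it must respect ≈ on states and ≐ on subsets
-- (its values on non-closed predicates are irrelevant junk).

record NbhdFn {A : Set} (_≈_ : Rel A 0ℓ) : Set₁ where
  field
    ν      : A → Pred A 0ℓ → Set
    ν-ext  : ∀ s {X Y : Pred A 0ℓ} → X Respects _≈_ → X ≐ Y → ν s X → ν s Y
    ν-resp : ∀ {s t} (X : Pred A 0ℓ) → X Respects _≈_ → s ≈ t → ν s X → ν t X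

record SFrame : Set₁ where
  field
    Carrier       : Set
    _≈_           : Rel Carrier 0ℓ
    isEquivalence : IsEquivalence _≈_
    nbhd          : NbhdFn _≈_
  open NbhdFn nbhd public

toSFrame : Frame → SFrame
toSFrame 𝒮 = record
  { Carrier       = S
  ; _≈_           = _≡_
  ; isEquivalence = PE.isEquivalence
  ; nbhd          = record
      { ν      = ν
      ; ν-ext  = λ s _ X≐Y → ν-ext s X≐Y
      ; ν-resp = λ X _ s≡t νsX → subst (λ u → ν u X) s≡t νsX
      }
  }
  where open Frame 𝒮

record IsBoundedMorphism (𝒜 ℬ : SFrame)
       (f : SFrame.Carrier 𝒜 → SFrame.Carrier ℬ) : Set₁ where
  private
    module A = SFrame 𝒜
    module B = SFrame ℬ
  field
    f-cong : ∀ {a a'} → a A.≈ a' → f a B.≈ f a'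
    bound  : ∀ (X : Pred B.Carrier 0ℓ) → X Respects B._≈_ →
             ∀ (s : A.Carrier) → A.ν s (X ∘ f) ⇔ B.ν (f s) X

-- 2²-bisimulations.  The relation R ⊆ S₁ × S₂ as a set: pairs related
-- by R, two elements being equal iff they are the same pair.

module _ (𝒮₁ 𝒮₂ : Frame) where
  private
    module F₁ = Frame 𝒮₁
    module F₂ = Frame 𝒮₂

  samePair : (R : F₁.S → F₂.S → Set) → Rel (Σ (F₁.S × F₂.S) (λ p → R (proj₁ p) (proj₂ p))) 0ℓ
  samePair R p q = proj₁ p ≡ proj₁ q

  RelFrame : (R : F₁.S → F₂.S → Set) → NbhdFn (samePair R) → SFrame
  RelFrame R N = record
    { Carrier       = Σ (F₁.S × F₂.S) (λ p → R (proj₁ p) (proj₂ p))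
    ; _≈_           = samePair R
    ; isEquivalence = record { refl = refl ; sym = sym ; trans = trans }
    ; nbhd          = N
    }

  Is2²Bisimulation : (R : F₁.S → F₂.S → Set) → Set₁
  Is2²Bisimulation R =
    Σ[ N ∈ NbhdFn (samePair R) ]
      ( IsBoundedMorphism (RelFrame R N) (toSFrame 𝒮₁) (proj₁ ∘ proj₁)
      × IsBoundedMorphism (RelFrame R N) (toSFrame 𝒮₂) (proj₂ ∘ proj₁) )

  -- Pushout of the span  S₁ ← R → S₂  in Set:  (S₁ + S₂)/θ, θ the
  -- equivalence relation generated by  (ι₁ x₁ , ι₂ x₂)  for  R x₁ x₂.
  data Glue (R : F₁.S → F₂.S → Set) : Rel (F₁.S ⊎ F₂.S) 0ℓ where
    glue : ∀ {x₁ x₂} → R x₁ x₂ → Glue R (inj₁ x₁) (inj₂ x₂)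

  θ : (R : F₁.S → F₂.S → Set) → Rel (F₁.S ⊎ F₂.S) 0ℓ
  θ R = EqClosure (Glue R)

  PushoutFrame : (R : F₁.S → F₂.S → Set) → NbhdFn (θ R) → SFrame
  PushoutFrame R N = record
    { Carrier       = F₁.S ⊎ F₂.S
    ; _≈_           = θ R
    ; isEquivalence = EqC.isEquivalence (Glue R)
    ; nbhd          = N
    }

  IsPrecocongruence : (R : F₁.S → F₂.S → Set) → Set₁
  IsPrecocongruence R =
    Σ[ N ∈ NbhdFn (θ R) ]
      ( IsBoundedMorphism (toSFrame 𝒮₁) (PushoutFrame R N) inj₁
      × IsBoundedMorphism (toSFrame 𝒮₂) (PushoutFrame R N) inj₂ )

  2²-Bisimilar : F₁.S → F₂.S → Set₁
  2²-Bisimilar s₁ s₂ = Σ[ R ∈ (F₁.S → F₂.S → Set) ] (Is2²Bisimulation R × R s₁ s₂)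

  PrecocongruenceRelated : F₁.S → F₂.S → Set₁
  PrecocongruenceRelated s₁ s₂ = Σ[ R ∈ (F₁.S → F₂.S → Set) ] (IsPrecocongruence R × R s₁ s₂)

  -- Common target frames are (setoid) frames with carrier in Set.
  BehaviourallyEquivalent : F₁.S → F₂.S → Set₁
  BehaviourallyEquivalent s₁ s₂ =
    Σ[ 𝒯 ∈ SFrame ]
    Σ[ f₁ ∈ (F₁.S → SFrame.Carrier 𝒯) ]
    Σ[ f₂ ∈ (F₂.S → SFrame.Carrier 𝒯) ]
      ( IsBoundedMorphism (toSFrame 𝒮₁) 𝒯 f₁
      × IsBoundedMorphism (toSFrame 𝒮₂) 𝒯 f₂
      × SFrame._≈_ 𝒯 (f₁ s₁) (f₂ s₂) )

-- Congruences: an equivalence relation R on S such that S/R (setoid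
-- (S , R)) carries a neighbourhood function making the quotient map
-- (the identity on representatives) a bounded morphism.

QuotientFrame : (𝒮 : Frame) (R : Rel (Frame.S 𝒮) 0ℓ) → IsEquivalence R → NbhdFn R → SFrame
QuotientFrame 𝒮 R eq N = record
  { Carrier = Frame.S 𝒮 ; _≈_ = R ; isEquivalence = eq ; nbhd = N }

IsCongruence : (𝒮 : Frame) (R : Rel (Frame.S 𝒮) 0ℓ) → IsEquivalence R → Set₁
IsCongruence 𝒮 R eq =
  Σ[ N ∈ NbhdFn R ] IsBoundedMorphism (toSFrame 𝒮) (QuotientFrame 𝒮 R eq N) id

module Submission where

-- The proof is organised around one notion: R is *invariant* when
-- ν s X ⇔ ν t X for all R-related s, t and all R-closed subsets X.
--   * transfer: two bounded morphisms into a common frame identify the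
--     neighbourhoods of a and b on preimages of closed subsets whenever
--     they identify a and b.  Hence precocongruences and congruences are
--     invariant, and so is the relation generated by the kernels of the two
--     legs of a behavioural equivalence.
--   * Conversely the canonical neighbourhood function ν̂ (ιᵢ x) X = ν x (X ∘ ιᵢ)
--     on S + S descends to the pushout as soon as it is *coherent* on the
--     glued pairs; every 2²-bisimulation and every invariant equivalence is
--     coherent.
--   * An invariant equivalence carries an explicit bisimulation structure
--     on its graph, and equals its own quotient structure (a congruence).

open import Defs
open import Level using (0ℓ)
open import Function.Base using (_∘_; id)
open import Function.Bundles using (_⇔_; mk⇔; Equivalence)
open import Function.Properties.Equivalence using (⇔-isEquivalence; ⇔-setoid)
open import Data.Bool using (Bool; true; false)
open import Data.Product using (_×_; Σ; Σ-syntax; _,_; proj₁; proj₂)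
open import Data.Sum using (_⊎_; inj₁; inj₂; [_,_])
import Data.Sum as Sum
open import Relation.Unary using (Pred; _≐_)
open import Relation.Unary.Properties using (≐-refl; ≐-sym; ≐-trans)
open import Relation.Binary.Core using (Rel)
open import Relation.Binary.Structures using (IsEquivalence)
open import Relation.Binary.Definitions using (_Respects_)
open import Relation.Binary.PropositionalEquality using (refl; cong; subst)
open import Relation.Binary.Construct.Closure.Equivalence as EqC using (EqClosure)
import Relation.Binary.Reasoning.Setoid as SetoidReasoning

module ⇔-Reasoning = SetoidReasoning (⇔-setoid 0ℓ)

⇔-along : {A : Set} {G : Rel A 0ℓ} (P : A → Set) →
          (∀ {a b} → G a b → P a ⇔ P b) →
          ∀ {a b} → EqClosure G a b → P a ⇔ P b
⇔-along P step = EqC.gfold ⇔-isEquivalence P step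

closed-along : {A : Set} {G : Rel A 0ℓ} (X : Pred A 0ℓ) →
               (∀ {a b} → G a b → X a ⇔ X b) → X Respects EqClosure G
closed-along X step r = Equivalence.to (⇔-along X step r)

module _ (𝒜 : SFrame) where
  open SFrame 𝒜

  ν-cong : ∀ s {X Y : Pred Carrier 0ℓ} → X Respects _≈_ → Y Respects _≈_ →
           X ≐ Y → ν s X ⇔ ν s Y
  ν-cong s X-closed Y-closed X≐Y =
    mk⇔ (ν-ext s X-closed X≐Y) (ν-ext s Y-closed (≐-sym X≐Y))

  ν-resp⇔ : ∀ {s t} (X : Pred Carrier 0ℓ) → X Respects _≈_ → s ≈ t → ν s X ⇔ ν t X
  ν-resp⇔ X X-closed s≈t =
    mk⇔ (ν-resp X X-closed s≈t) (ν-resp X X-closed (IsEquivalence.sym isEquivalence s≈t))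

module _ {𝒜 ℬ 𝒯 : SFrame} where
  private
    module A = SFrame 𝒜
    module B = SFrame ℬ
    module T = SFrame 𝒯

  transfer : {f : A.Carrier → T.Carrier} {g : B.Carrier → T.Carrier} →
             IsBoundedMorphism 𝒜 𝒯 f → IsBoundedMorphism ℬ 𝒯 g →
             (Y : Pred T.Carrier 0ℓ) → Y Respects T._≈_ →
             ∀ {a b} → f a T.≈ g b → A.ν a (Y ∘ f) ⇔ B.ν b (Y ∘ g)
  transfer {f} {g} bm-f bm-g Y Y-closed {a} {b} fa≈gb = begin
      A.ν a (Y ∘ f)  ≈⟨ IsBoundedMorphism.bound bm-f Y Y-closed a ⟩
      T.ν (f a) Y    ≈⟨ ν-resp⇔ 𝒯 Y Y-closed fa≈gb ⟩
      T.ν (g b) Y    ≈⟨ IsBoundedMorphism.bound bm-g Y Y-closed b ⟨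
      B.ν b (Y ∘ g)  ∎
    where open ⇔-Reasoning

module _ (𝒮 : Frame) where
  open Frame 𝒮

  ν⇔ : ∀ s {X Y : Pred S 0ℓ} → X ≐ Y → ν s X ⇔ ν s Y
  ν⇔ s X≐Y = mk⇔ (ν-ext s X≐Y) (ν-ext s (≐-sym X≐Y))

  Invariant : Rel S 0ℓ → Set₁
  Invariant R = ∀ (X : Pred S 0ℓ) → X Respects R →
                ∀ {s t} → R s t → ν s X ⇔ ν t X

  -- A congruence is the same thing as an invariant relation: the quotient
  -- structure is forced to be ν itself, read on R-closed sets.
  congruence⇔invariant : (R : Rel S 0ℓ) (eq : IsEquivalence R) →
                         IsCongruence 𝒮 R eq ⇔ Invariant R
  congruence⇔invariant R eq = mk⇔ invariant quotient
    where
    invariant : IsCongruence 𝒮 R eq → Invariant R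
    invariant (_ , bm) X X-closed r = transfer bm bm X X-closed r

    quotient : Invariant R → IsCongruence 𝒮 R eq
    quotient inv =
        record { ν      = ν
               ; ν-ext  = λ s _ → ν-ext s
               ; ν-resp = λ X X-closed r → Equivalence.to (inv X X-closed r) }
      , record { f-cong = λ { refl → IsEquivalence.refl eq }
               ; bound  = λ X _ s → mk⇔ id id }

  Coherent : (R : S → S → Set) → Set₁
  Coherent R = ∀ (X : Pred (S ⊎ S) 0ℓ) → X Respects θ 𝒮 𝒮 R →
               ∀ {x y} → R x y → ν x (X ∘ inj₁) ⇔ ν y (X ∘ inj₂)

  coherent⇒precongruence : (R : S → S → Set) → Coherent R → IsPrecocongruence 𝒮 𝒮 R
  coherent⇒precongruence R coherent = N , bm₁ , bm₂
    where
    ν̂ : S ⊎ S → Pred (S ⊎ S) 0ℓ → Set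
    ν̂ (inj₁ x) X = ν x (X ∘ inj₁)
    ν̂ (inj₂ y) X = ν y (X ∘ inj₂)

    N : NbhdFn (θ 𝒮 𝒮 R)
    N = record
      { ν      = ν̂
      ; ν-ext  = λ { (inj₁ x) _ (h , k) → ν-ext x (h , k)
                   ; (inj₂ y) _ (h , k) → ν-ext y (h , k) }
      ; ν-resp = λ X X-closed u≈v → Equivalence.to
          (⇔-along (λ u → ν̂ u X) (λ { (glue r) → coherent X X-closed r }) u≈v)
      }

    bm₁ : IsBoundedMorphism (toSFrame 𝒮) (PushoutFrame 𝒮 𝒮 R N) inj₁
    bm₁ = record { f-cong = λ { refl → EqC.reflexive _ }
                 ; bound  = λ X _ s → mk⇔ id id }

    bm₂ : IsBoundedMorphism (toSFrame 𝒮) (PushoutFrame 𝒮 𝒮 R N) inj₂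
    bm₂ = record { f-cong = λ { refl → EqC.reflexive _ }
                 ; bound  = λ X _ s → mk⇔ id id }

  -- Every 2²-bisimulation (not necessarily an equivalence) is coherent: pass
  -- through the neighbourhoods of the pair (x , y) in the bisimulation frame,
  -- on which the two preimages of a θ-closed set agree.
  bisimulation⇒coherent : (R : S → S → Set) → Is2²Bisimulation 𝒮 𝒮 R → Coherent R
  bisimulation⇒coherent R (N , bm₁ , bm₂) X X-closed {x} {y} r = begin
      ν x X₁              ≈⟨ IsBoundedMorphism.bound bm₁ X₁ (subst X₁) p ⟨
      N.ν p (X₁ ∘ π₁)     ≈⟨ legs-neighbourhoods ⟩
      N.ν p (X₂ ∘ π₂)     ≈⟨ IsBoundedMorphism.bound bm₂ X₂ (subst X₂) p ⟩
      ν y X₂              ∎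
    where
    open ⇔-Reasoning
    module N = NbhdFn N
    Pair : Set
    Pair = Σ (S × S) (λ q → R (proj₁ q) (proj₂ q))
    π₁ π₂ : Pair → S
    π₁ = proj₁ ∘ proj₁
    π₂ = proj₂ ∘ proj₁
    p : Pair
    p = (x , y) , r
    X₁ X₂ : Pred S 0ℓ
    X₁ = X ∘ inj₁
    X₂ = X ∘ inj₂

    first-closed : (X₁ ∘ π₁) Respects samePair 𝒮 𝒮 R
    first-closed = subst (X₁ ∘ proj₁)
    second-closed : (X₂ ∘ π₂) Respects samePair 𝒮 𝒮 R
    second-closed = subst (X₂ ∘ proj₂)

    legs-agree : (X₁ ∘ π₁) ≐ (X₂ ∘ π₂)
    legs-agree = (λ { {_ , r'} → X-closed (EqC.return (glue r')) })
               , (λ { {_ , r'} → X-closed (EqC.symmetric _ (EqC.return (glue r'))) })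

    legs-neighbourhoods : N.ν p (X₁ ∘ π₁) ⇔ N.ν p (X₂ ∘ π₂)
    legs-neighbourhoods = ν-cong (RelFrame 𝒮 𝒮 R N) p (λ {q} {q'} → first-closed {q} {q'})
      (λ {q} {q'} → second-closed {q} {q'}) legs-agree

  bisimulation⇒precongruence : (R : S → S → Set) → Is2²Bisimulation 𝒮 𝒮 R →
                               IsPrecocongruence 𝒮 𝒮 R
  bisimulation⇒precongruence R = coherent⇒precongruence R ∘ bisimulation⇒coherent R

  -- An invariant equivalence is coherent: a θ-closed X has R-closed and
  -- equal restrictions to the two summands.
  invariant⇒coherent : (R : Rel S 0ℓ) → IsEquivalence R → Invariant R → Coherent R
  invariant⇒coherent R eq inv X X-closed {x} {y} r = begin
      ν x X₁  ≈⟨ inv X₁ X₁-closed r ⟩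
      ν y X₁  ≈⟨ ν⇔ y summands-agree ⟩
      ν y X₂  ∎
    where
    open ⇔-Reasoning
    X₁ X₂ : Pred S 0ℓ
    X₁ = X ∘ inj₁
    X₂ = X ∘ inj₂

    glued : ∀ {a b} → R a b → θ 𝒮 𝒮 R (inj₁ a) (inj₂ b)
    glued = EqC.return ∘ glue

    unglued : ∀ {a b} → R a b → θ 𝒮 𝒮 R (inj₂ b) (inj₁ a)
    unglued = EqC.symmetric _ ∘ glued

    X₁-closed : X₁ Respects R
    X₁-closed a~b = X-closed (EqC.transitive _ (glued a~b) (unglued (IsEquivalence.refl eq)))

    summands-agree : X₁ ≐ X₂
    summands-agree = X-closed (glued (IsEquivalence.refl eq))
                   , X-closed (unglued (IsEquivalence.refl eq))

  invariant⇒precongruence : (R : Rel S 0ℓ) → IsEquivalence R → Invariant R →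
                            IsPrecocongruence 𝒮 𝒮 R
  invariant⇒precongruence R eq = coherent⇒precongruence R ∘ invariant⇒coherent R eq

  -- A precocongruence is invariant: transfer along the two injections into
  -- the pushout, using the θ-closed set X + X.
  precongruence⇒invariant : (R : Rel S 0ℓ) → IsEquivalence R →
                            IsPrecocongruence 𝒮 𝒮 R → Invariant R
  precongruence⇒invariant R eq (_ , bm₁ , bm₂) X X-closed r =
    transfer bm₁ bm₂ [ X , X ] doubled-closed (EqC.return (glue r))
    where
    doubled-closed : [ X , X ] Respects θ 𝒮 𝒮 R
    doubled-closed = closed-along [ X , X ] λ { (glue a~b) →
      mk⇔ (X-closed a~b) (X-closed (IsEquivalence.sym eq a~b)) }

  -- A subset Z of the graph
  -- of R is a neighbourhood of (x , y) when Z is the preimage, along one of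
  -- the projections, of its own diagonal restriction Z ∘ δ, and Z ∘ δ is a
  -- neighbourhood of the corresponding component.  If X ∘ π₁ happens to be
  -- also a preimage along π₂, then X is R-closed and invariance reconciles
  -- the two components.
  invariant⇒bisimulation : (R : Rel S 0ℓ) → IsEquivalence R → Invariant R →
                           Is2²Bisimulation 𝒮 𝒮 R
  invariant⇒bisimulation R eq inv = N , bm₁ , bm₂
    where
    Pair : Set
    Pair = Σ (S × S) (λ q → R (proj₁ q) (proj₂ q))
    π₁ π₂ : Pair → S
    π₁ = proj₁ ∘ proj₁
    π₂ = proj₂ ∘ proj₁
    δ : S → Pair
    δ a = (a , a) , IsEquivalence.refl eq

    Via : (Pair → S) → Pred Pair 0ℓ → S → Set
    Via π Z s = (Z ≐ (Z ∘ δ ∘ π)) × ν s (Z ∘ δ)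

    via-cong : ∀ π s {Z Z'} → Z ≐ Z' → Via π Z s → Via π Z' s
    via-cong π s Z≐Z'@(h , k) (factors , n) =
      ≐-trans (≐-sym Z≐Z') (≐-trans factors (h , k)) , ν-ext s (h , k) n

    N : NbhdFn (samePair 𝒮 𝒮 R)
    N = record
      { ν      = λ p Z → Via π₁ Z (π₁ p) ⊎ Via π₂ Z (π₂ p)
      ; ν-ext  = λ p _ Z≐Z' → Sum.map (via-cong π₁ (π₁ p) Z≐Z') (via-cong π₂ (π₂ p) Z≐Z')
      ; ν-resp = λ Z _ p≡q → subst (λ u → Via π₁ Z (proj₁ u) ⊎ Via π₂ Z (proj₂ u)) p≡q
      }

    closed-if-legs-agree : (X : Pred S 0ℓ) → (X ∘ π₁) ≐ (X ∘ π₂) → X Respects R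
    closed-if-legs-agree X (h , _) a~b = h {(_ , _) , a~b}

    bm₁ : IsBoundedMorphism (RelFrame 𝒮 𝒮 R N) (toSFrame 𝒮) π₁
    bm₁ = record
      { f-cong = cong proj₁
      ; bound  = λ X _ p → mk⇔
          (λ { (inj₁ (_ , n)) → n
             ; (inj₂ (agree , n)) →
                 Equivalence.from (inv X (closed-if-legs-agree X agree) (proj₂ p)) n })
          (λ n → inj₁ (≐-refl , n))
      }

    bm₂ : IsBoundedMorphism (RelFrame 𝒮 𝒮 R N) (toSFrame 𝒮) π₂
    bm₂ = record
      { f-cong = cong proj₂
      ; bound  = λ X _ p → mk⇔
          (λ { (inj₂ (_ , n)) → n
             ; (inj₁ (agree , n)) →
                 Equivalence.to (inv X (closed-if-legs-agree X (≐-sym agree)) (proj₂ p)) n })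
          (λ n → inj₂ (≐-refl , n))
      }

  -- For a family of bounded morphisms F i into a common frame 𝒯, the
  -- equivalence generated by "F i a ≈ F j b" is invariant: an X closed under
  -- it is the preimage, along every F k, of its joint image in 𝒯.
  module JointKernel (𝒯 : SFrame) {I : Set} (F : I → S → SFrame.Carrier 𝒯)
                     (bm : ∀ i → IsBoundedMorphism (toSFrame 𝒮) 𝒯 (F i)) where
    open SFrame 𝒯 using () renaming (Carrier to T; _≈_ to _≈ₜ_; isEquivalence to ≈ₜ-equiv)

    Identified : Rel S 0ℓ
    Identified a b = Σ[ i ∈ I ] Σ[ j ∈ I ] F i a ≈ₜ F j b

    Kernel : Rel S 0ℓ
    Kernel = EqClosure Identified

    kernel-invariant : Invariant Kernel
    kernel-invariant X X-closed = ⇔-along (λ u → ν u X) identified-step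
      where
      Image : Pred T 0ℓ
      Image t = Σ[ c ∈ S ] Σ[ k ∈ I ] X c × F k c ≈ₜ t

      image-closed : Image Respects _≈ₜ_
      image-closed t≈t' (c , k , x , e) = c , k , x , IsEquivalence.trans ≈ₜ-equiv e t≈t'

      preimage : ∀ k → X ≐ (Image ∘ F k)
      preimage k = (λ {c} x → c , k , x , IsEquivalence.refl ≈ₜ-equiv)
                 , (λ { (c , k' , x , e) → X-closed (EqC.return (k' , k , e)) x })

      identified-step : ∀ {a b} → Identified a b → ν a X ⇔ ν b X
      identified-step {a} {b} (i , j , e) = begin
          ν a X             ≈⟨ ν⇔ a (preimage i) ⟩
          ν a (Image ∘ F i) ≈⟨ transfer (bm i) (bm j) Image image-closed e ⟩
          ν b (Image ∘ F j) ≈⟨ ν⇔ b (preimage j) ⟨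
          ν b X             ∎
        where open ⇔-Reasoning

  behavioural⇒invariant : ∀ {s₁ s₂} → BehaviourallyEquivalent 𝒮 𝒮 s₁ s₂ →
                          Σ[ K ∈ Rel S 0ℓ ] (IsEquivalence K × Invariant K × K s₁ s₂)
  behavioural⇒invariant (𝒯 , f₁ , f₂ , bm₁ , bm₂ , f₁s₁≈f₂s₂) =
    Kernel , EqC.isEquivalence _ , kernel-invariant , EqC.return (true , false , f₁s₁≈f₂s₂)
    where
    F : Bool → S → SFrame.Carrier 𝒯
    F true  = f₁
    F false = f₂
    bm : ∀ i → IsBoundedMorphism (toSFrame 𝒮) 𝒯 (F i)
    bm true  = bm₁
    bm false = bm₂
    open JointKernel 𝒯 F bm

  related⇒behavioural : ∀ {s₁ s₂} → PrecocongruenceRelated 𝒮 𝒮 s₁ s₂ →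
                        BehaviourallyEquivalent 𝒮 𝒮 s₁ s₂
  related⇒behavioural (R , (N , bm₁ , bm₂) , r) =
    PushoutFrame 𝒮 𝒮 R N , inj₁ , inj₂ , bm₁ , bm₂ , EqC.return (glue r)

proposition3p20 : (𝒮 : Frame) (R : Rel (Frame.S 𝒮) 0ℓ) (eq : IsEquivalence R) →
    ( (Is2²Bisimulation 𝒮 𝒮 R ⇔ IsPrecocongruence 𝒮 𝒮 R)
    × (IsPrecocongruence 𝒮 𝒮 R ⇔ IsCongruence 𝒮 R eq) )
    × (∀ (s₁ s₂ : Frame.S 𝒮) →
        (2²-Bisimilar 𝒮 𝒮 s₁ s₂ ⇔ PrecocongruenceRelated 𝒮 𝒮 s₁ s₂)
      × (PrecocongruenceRelated 𝒮 𝒮 s₁ s₂ ⇔ BehaviourallyEquivalent 𝒮 𝒮 s₁ s₂))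
proposition3p20 𝒮 R eq =
    ( mk⇔ (bisimulation⇒precongruence 𝒮 R)
          (invariant⇒bisimulation 𝒮 R eq ∘ precongruence⇒invariant 𝒮 R eq)
    , mk⇔ (Equivalence.from (congruence⇔invariant 𝒮 R eq) ∘ precongruence⇒invariant 𝒮 R eq)
          (invariant⇒precongruence 𝒮 R eq ∘ Equivalence.to (congruence⇔invariant 𝒮 R eq)) )
  , λ s₁ s₂ →
    ( mk⇔ (λ { (R' , bisim , r) → R' , bisimulation⇒precongruence 𝒮 R' bisim , r })
          (bisimilar ∘ related⇒behavioural 𝒮)
    , mk⇔ (related⇒behavioural 𝒮) related )
  where
  bisimilar : ∀ {s₁ s₂} → BehaviourallyEquivalent 𝒮 𝒮 s₁ s₂ → 2²-Bisimilar 𝒮 𝒮 s₁ s₂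
  bisimilar beh with behavioural⇒invariant 𝒮 beh
  ... | K , K-equiv , K-inv , k = K , invariant⇒bisimulation 𝒮 K K-equiv K-inv , k

  related : ∀ {s₁ s₂} → BehaviourallyEquivalent 𝒮 𝒮 s₁ s₂ → PrecocongruenceRelated 𝒮 𝒮 s₁ s₂
  related beh with behavioural⇒invariant 𝒮 beh
  ... | K , K-equiv , K-inv , k = K , invariant⇒precongruence 𝒮 K K-equiv K-inv , k
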